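{- Let $G$ be a finite connected graph of diameter $D$. Then $\tau(G)$ equals the minimum cardinality of a set $W\subseteq V(G)$ such that there is a $W$-resolved embedding of $G$ in $P_{D+1}^{\boxtimes,|W|}$.
   Context: For vertices $x,y$ of a connected graph, $d(x,y)$ is the distance. A set $W$ of vertices is a resolving set of a graph if for every pair of distinct vertices $u,v$ there is $w\in W$ with $d(u,w)\neq d(v,w)$; the metric dimension $\beta(H)$ is the minimum size of a resolving set of $H$. $\mathcal{U}(G)$ is the set of all graphs containing $G$ as a spanning subgraph, and the threshold dimension is $\tau(G)=\min\{\beta(H): H\in\mathcal{U}(G)\}$. The path $P_n$ has vertex set $\{0,\dots,n-1\}$ with $i\sim i+1$; $P_n^{\boxtimes,k}$ has vertex set $\{0,\dots,n-1\}^k$, distinct vertices $x,y$ adjacent iff $|x_i-y_i|\le1$ for all $i$. An embedding of $G$ in $H'$ is an injective edge-preserving map $\varphi:V(G)\to V(H')$; $\varphi(G)$ is the subgraph of $H'$ induced by $\varphi(V(G))$. For $W=\{w_1,\dots,w_k\}\subseteq V(G)$, a $W$-resolved embedding of $G$ in $P^{\boxtimes,k}$ is an embedding $\varphi$ with $\varphi(x)=\left(d_{\varphi(G)}(\varphi(w_1),\varphi(x)),\dots,d_{\varphi(G)}(\varphi(w_k),\varphi(x))\right)$ for all $x\in V(G)$. -}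

module Defs where

open import Data.Nat using (ℕ; zero; suc; _≤_; ∣_-_∣)
open import Data.Fin using (Fin; toℕ)
open import Data.Vec using (Vec; lookup)
open import Data.Product using (Σ; ∃; ∃-syntax; _×_)
open import Relation.Nullary using (¬_)
open import Relation.Binary.PropositionalEquality using (_≡_; _≢_)
open import Function.Definitions using (Injective)
open import Function.Bundles using (_⇔_)
open import Level using (Level)

record Graph (n : ℕ) : Set₁ where
  field
    Adj    : Fin n → Fin n → Set
    sym    : ∀ {x y} → Adj x y → Adj y x
    irrefl : ∀ {x} → ¬ Adj x x
open Graph public

data Walk {n : ℕ} (A : Fin n → Fin n → Set) : Fin n → Fin n → ℕ → Set where
  here : ∀ {x} → Walk A x x zero
  step : ∀ {x y z k} → A x y → Walk A y z k → Walk A x z (suc k)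

IsDist : {n : ℕ} → (Fin n → Fin n → Set) → Fin n → Fin n → ℕ → Set
IsDist A x y k = Walk A x y k × (∀ m → Walk A x y m → k ≤ m)

Connected : {n : ℕ} → Graph n → Set
Connected G = ∀ x y → ∃[ k ] Walk (Adj G) x y k

IsDiameter : {n : ℕ} → Graph n → ℕ → Set
IsDiameter G D =
  (∀ x y → ∃[ k ] (IsDist (Adj G) x y k × k ≤ D))
  × (∃[ x ] ∃[ y ] IsDist (Adj G) x y D)

IsMin : {ℓ : Level} → (ℕ → Set ℓ) → ℕ → Set ℓ
IsMin P m = P m × (∀ k → P k → m ≤ k)

-- A set W ⊆ V of cardinality k, listed as w₁,…,w_k (an injection Fin k → Fin n).
VertexSet : ℕ → ℕ → Set
VertexSet n k = Σ (Fin k → Fin n) Injective′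
  where Injective′ : (Fin k → Fin n) → Set
        Injective′ w = Injective _≡_ _≡_ w

Resolving : {n k : ℕ} → Graph n → (Fin k → Fin n) → Set
Resolving H w = ∀ u v → u ≢ v →
  ∃[ i ] ∃[ a ] ∃[ b ] (IsDist (Adj H) u (w i) a × IsDist (Adj H) v (w i) b × a ≢ b)

HasResolvingSetOfSize : {n : ℕ} → Graph n → ℕ → Set
HasResolvingSetOfSize {n} H k = Σ (VertexSet n k) λ W → Resolving H (Data.Product.proj₁ W)

IsMetricDim : {n : ℕ} → Graph n → ℕ → Set
IsMetricDim H b = IsMin (HasResolvingSetOfSize H) b

-- H ∈ 𝒰(G): H contains G as a spanning subgraph.
Supergraph : {n : ℕ} → Graph n → Graph n → Set
Supergraph G H = ∀ x y → Adj G x y → Adj H x y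

IsThresholdDim : {n : ℕ} → Graph n → ℕ → Set₁
IsThresholdDim {n} G t =
  IsMin (λ s → Σ (Graph n) λ H → Supergraph G H × IsMetricDim H s) t

-- Vertices of P_N^{⊠,k}: vectors in {0,…,N-1}^k; adjacency of the strong product.
StrongAdj : {N k : ℕ} → Vec (Fin N) k → Vec (Fin N) k → Set
StrongAdj x y = x ≢ y × (∀ i → ∣ toℕ (lookup x i) - toℕ (lookup y i) ∣ ≤ 1)

IsEmbedding : {n N k : ℕ} → Graph n → (Fin n → Vec (Fin N) k) → Set
IsEmbedding G φ = Injective _≡_ _≡_ φ × (∀ x y → Adj G x y → StrongAdj (φ x) (φ y))

-- Adjacency of φ(G) (induced subgraph on φ(V(G))), pulled back along the injection φ.
ImageAdj : {n N k : ℕ} → (Fin n → Vec (Fin N) k) → Fin n → Fin n → Set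
ImageAdj φ x y = StrongAdj (φ x) (φ y)

IsWResolvedEmbedding : {n N k : ℕ} → Graph n → (Fin k → Fin n) → (Fin n → Vec (Fin N) k) → Set
IsWResolvedEmbedding G w φ =
  IsEmbedding G φ × (∀ x i → IsDist (ImageAdj φ) (w i) x (toℕ (lookup (φ x) i)))

HasResolvedEmbeddingOfSize : {n : ℕ} → Graph n → ℕ → ℕ → Set
HasResolvedEmbeddingOfSize {n} G N k =
  Σ (VertexSet n k) λ W → Σ (Fin n → Vec (Fin N) k) λ φ →
    IsWResolvedEmbedding G (Data.Product.proj₁ W) φ

module Submission where

-- If H ⊇ G is spanning and W = (w₁,…,w_k) resolves H, then x ↦ (d_H(w_i, x))_i is a W-resolved
-- embedding of G in P_{D+1}^{⊠,k}: coordinates are at most D because d_H ≤ d_G, and an H-edge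
-- changes every distance by at most one, so H-walks map to φ(G)-walks; conversely the i-th
-- coordinate changes by at most one along each φ(G)-edge and vanishes at φ(w_i), hence
-- d_{φ(G)}(φ(w_i), φ(x)) = d_H(w_i, x). In the other direction a W-resolved embedding φ makes
-- φ(G), pulled back to V(G), a supergraph of G resolved by W, since distinct vertices have
-- distinct coordinate vectors. So the two minima range over the same sizes.

open import Defs
open import Data.Nat using (ℕ; suc)
open import Function.Bundles using (_⇔_)

open import Data.Nat using (zero; _≤_; _<_; _+_; z≤n; s≤s; _≤?_; _≟_; ∣_-_∣)
open import Data.Nat.Induction using (<-rec)
open import Data.Nat.Properties
  using (≤-refl; ≤-reflexive; ≤-trans; ≤-antisym; <⇒≤; <⇒≱; ≰⇒>; ≮⇒≥; +-identityʳ; +-suc; +-monoˡ-≤;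
         ∣-∣-comm; anyUpTo?; allUpTo?; module ≤-Reasoning)
open import Data.Fin using (Fin; toℕ; fromℕ<) renaming (zero to fzero; suc to fsuc)
open import Data.Fin.Properties using (any?; all?; ¬∀⟶∃¬; toℕ-fromℕ<; toℕ-injective)
  renaming (_≟_ to _≟ᶠ_)
open import Data.Vec using (Vec; []; _∷_; lookup; tabulate)
open import Data.Vec.Properties using (≡-dec; lookup∘tabulate; tabulate∘lookup; tabulate-cong)
open import Data.Empty using (⊥-elim)
open import Data.Product using (Σ; _×_; _,_; proj₁; proj₂)
open import Function.Base using (_∘_)
open import Function.Bundles using (mk⇔; module Equivalence)
open import Function.Definitions using (Injective)
open import Level using (Level)
open import Relation.Binary.Definitions using (Decidable; DecidableEquality)
open import Relation.Binary.PropositionalEquality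
  using (_≡_; refl; trans; cong; subst; subst₂; module ≡-Reasoning)
  renaming (sym to ≡-sym)
open import Relation.Nullary using (¬_; Dec; yes; no)
open import Relation.Nullary.Decidable using (decidable-stable; _→-dec_; _×-dec_; ¬?; map′)
open import Relation.Nullary.Negation using (DoubleNegation)

private
  variable
    ℓ : Level
    n k : ℕ

IsMin-unique : {P : ℕ → Set ℓ} {a b : ℕ} → IsMin P a → IsMin P b → a ≡ b
IsMin-unique (pa , a-min) (pb , b-min) = ≤-antisym (a-min _ pb) (b-min _ pa)

minimum : {P : ℕ → Set ℓ} → (∀ m → Dec (P m)) → ∀ k → P k → Σ ℕ λ m → IsMin P m × m ≤ k
minimum {P = P} P? = <-rec (λ k → P k → Σ ℕ λ m → IsMin P m × m ≤ k) search
  where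
  search : ∀ k → (∀ {j} → j < k → P j → Σ ℕ λ m → IsMin P m × m ≤ j) →
           P k → Σ ℕ λ m → IsMin P m × m ≤ k
  search k below pk with anyUpTo? P? k
  ... | yes (j , j<k , pj) with below j<k pj
  ...   | m , m-min , m≤j = m , m-min , ≤-trans m≤j (<⇒≤ j<k)
  search k below pk | no none = k , (pk , λ j pj → ≮⇒≥ (λ j<k → none (j , j<k , pj))) , ≤-refl

¬¬-minimum : {P : ℕ → Set ℓ} → ∀ k → P k → DoubleNegation (Σ ℕ (IsMin P))
¬¬-minimum {P = P} k pk no-min = <-rec (λ k → ¬ P k) minimal k pk
  where
  minimal : ∀ k → (∀ {j} → j < k → ¬ P j) → ¬ P k
  minimal k below pk = no-min (k , pk , λ j pj →
    decidable-stable (k ≤? j) (λ k≰j → below (≰⇒> k≰j) pj))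

isMin? : {P : ℕ → Set ℓ} → (∀ m → Dec (P m)) → ∀ k → Dec (IsMin P k)
isMin? {P = P} P? k = P? k ×-dec map′ lower-bound nothing-below (allUpTo? (¬? ∘ P?) k)
  where
  lower-bound : (∀ {j} → j < k → ¬ P j) → ∀ j → P j → k ≤ j
  lower-bound below j pj = ≮⇒≥ (λ j<k → below j<k pj)
  nothing-below : (∀ j → P j → k ≤ j) → ∀ {j} → j < k → ¬ P j
  nothing-below k-min j<k pj = <⇒≱ j<k (k-min _ pj)

module _ {A : Fin n → Fin n → Set} where

  _∷ʳ_ : ∀ {x y z k} → Walk A x y k → A y z → Walk A x z (suc k)
  here       ∷ʳ e = step e here
  step e′ xs ∷ʳ e = step e′ (xs ∷ʳ e)

  reverse : (∀ {x y} → A x y → A y x) → ∀ {x y k} → Walk A x y k → Walk A y x k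
  reverse A-sym here        = here
  reverse A-sym (step e xs) = reverse A-sym xs ∷ʳ A-sym e

  walk? : Decidable A → ∀ k → Decidable (λ x y → Walk A x y k)
  walk? A? zero x y with x ≟ᶠ y
  ... | yes refl = yes here
  ... | no x≢y   = no λ { here → x≢y refl }
  walk? A? (suc k) x y with any? (λ z → A? x z ×-dec walk? A? k z y)
  ... | yes (z , e , xs) = yes (step e xs)
  ... | no none          = no λ { (step e xs) → none (_ , e , xs) }

  IsDist-refl : ∀ {x} → IsDist A x x 0
  IsDist-refl = here , λ _ _ → z≤n

  IsDist-sym : (∀ {x y} → A x y → A y x) → ∀ {x y k} → IsDist A x y k → IsDist A y x k
  IsDist-sym A-sym (xs , xs-min) = reverse A-sym xs , λ m ys → xs-min m (reverse A-sym ys)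

  IsDist-step : ∀ {w x y a b} → IsDist A w x a → A x y → IsDist A w y b → b ≤ suc a
  IsDist-step (xs , _) e (_ , ys-min) = ys-min _ (xs ∷ʳ e)

  distance : Decidable A → ∀ {x y k} → Walk A x y k → Σ ℕ λ d → IsDist A x y d × d ≤ k
  distance A? {x} {y} = minimum (λ m → walk? A? m x y) _

  IsDist? : Decidable A → ∀ x y k → Dec (IsDist A x y k)
  IsDist? A? x y = isMin? (λ m → walk? A? m x y)

  IsDist-one⇔adjacent : (∀ {x} → ¬ A x x) → ∀ {x y} → IsDist A x y 1 ⇔ A x y
  IsDist-one⇔adjacent A-irrefl = mk⇔ (λ { (step e here , _) → e })
    λ e → step e here , λ { zero here → ⊥-elim (A-irrefl e) ; (suc m) _ → s≤s z≤n }

walk-map : {A B : Fin n → Fin n → Set} → (∀ {x y} → A x y → B x y) →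
           ∀ {x y k} → Walk A x y k → Walk B x y k
walk-map f here        = here
walk-map f (step e xs) = step (f e) (walk-map f xs)

¬¬-∀-Fin : {P : Fin n → Set ℓ} → (∀ i → DoubleNegation (P i)) → DoubleNegation (∀ i → P i)
¬¬-∀-Fin {zero}  ¬¬P ¬∀ = ¬∀ λ ()
¬¬-∀-Fin {suc n} ¬¬P ¬∀ = ¬¬P fzero λ p₀ → ¬¬-∀-Fin (¬¬P ∘ fsuc) λ ps →
  ¬∀ λ { fzero → p₀ ; (fsuc i) → ps i }

¬¬-decidable : (A : Fin n → Fin n → Set) → DoubleNegation (Decidable A)
¬¬-decidable A = ¬¬-∀-Fin λ x → ¬¬-∀-Fin λ y ¬dec → ¬dec (no λ a → ¬dec (yes a))

Searchable : Set → Set₁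
Searchable A = ∀ {P : A → Set} → (∀ a → Dec (P a)) → Dec (Σ A P)

Fin-searchable : Searchable (Fin n)
Fin-searchable = any?

Vec-searchable : ∀ {A} → Searchable A → ∀ k → Searchable (Vec A k)
Vec-searchable search zero    P? with P? []
... | yes p = yes ([] , p)
... | no ¬p = no λ { ([] , p) → ¬p p }
Vec-searchable search (suc k) P? with search (λ a → Vec-searchable search k (P? ∘ (a ∷_)))
... | yes (a , as , p) = yes (a ∷ as , p)
... | no none          = no λ { (a ∷ as , p) → none (a , as , p) }

injective? : ∀ {B : Set} → DecidableEquality B → (f : Fin k → B) → Dec (Injective _≡_ _≡_ f)
injective? _≟ᴮ_ f = map′ (λ inj {x} {y} → inj x y) (λ inj x y → inj)
  (all? λ x → all? λ y → (f x ≟ᴮ f y) →-dec (x ≟ᶠ y))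

lookup-ext : ∀ {A : Set} (xs ys : Vec A k) → (∀ i → lookup xs i ≡ lookup ys i) → xs ≡ ys
lookup-ext xs ys eq = begin
  xs                ≡⟨ ≡-sym (tabulate∘lookup xs) ⟩
  tabulate (lookup xs) ≡⟨ tabulate-cong eq ⟩
  tabulate (lookup ys) ≡⟨ tabulate∘lookup ys ⟩
  ys                ∎
  where open ≡-Reasoning

∣m-n∣≤1 : ∀ m n → n ≤ suc m → m ≤ suc n → ∣ m - n ∣ ≤ 1
∣m-n∣≤1 zero          zero          _         _         = z≤n
∣m-n∣≤1 zero          (suc zero)    _         _         = s≤s z≤n
∣m-n∣≤1 (suc zero)    zero          _         _         = s≤s z≤n
∣m-n∣≤1 (suc m)       (suc n)       (s≤s n≤m) (s≤s m≤n) = ∣m-n∣≤1 m n n≤m m≤n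
∣m-n∣≤1 zero          (suc (suc n)) (s≤s ())  _
∣m-n∣≤1 (suc (suc m)) zero          _         (s≤s ())

∣m-n∣≤1⇒n≤1+m : ∀ m n → ∣ m - n ∣ ≤ 1 → n ≤ suc m
∣m-n∣≤1⇒n≤1+m zero    zero          _        = z≤n
∣m-n∣≤1⇒n≤1+m zero    (suc zero)    _        = s≤s z≤n
∣m-n∣≤1⇒n≤1+m zero    (suc (suc n)) (s≤s ())
∣m-n∣≤1⇒n≤1+m (suc m) zero          _        = z≤n
∣m-n∣≤1⇒n≤1+m (suc m) (suc n)       d≤1      = s≤s (∣m-n∣≤1⇒n≤1+m m n d≤1)

module _ {N : ℕ} where

  StrongAdj-sym : {x y : Vec (Fin N) k} → StrongAdj x y → StrongAdj y x
  StrongAdj-sym {x = x} {y} (x≢y , close) = x≢y ∘ ≡-sym , λ i →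
    subst (_≤ 1) (∣-∣-comm (toℕ (lookup x i)) (toℕ (lookup y i))) (close i)

  StrongAdj? : Decidable (StrongAdj {N} {k})
  StrongAdj? x y = ¬? (≡-dec _≟ᶠ_ x y) ×-dec all? λ i → ∣ toℕ (lookup x i) - toℕ (lookup y i) ∣ ≤? 1

  imageGraph : (Fin n → Vec (Fin N) k) → Graph n
  imageGraph φ = record { Adj = ImageAdj φ ; sym = StrongAdj-sym ; irrefl = λ adj → proj₁ adj refl }

  coordinate-≤ : (φ : Fin n → Vec (Fin N) k) (i : Fin k) → ∀ {x y m} → Walk (ImageAdj φ) x y m →
                 toℕ (lookup (φ y) i) ≤ toℕ (lookup (φ x) i) + m
  coordinate-≤ φ i {x} here = ≤-reflexive (≡-sym (+-identityʳ _))
  coordinate-≤ φ i {x} {y} {suc m} (step {y = z} (_ , close) zs) = begin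
    toℕ (lookup (φ y) i)       ≤⟨ coordinate-≤ φ i zs ⟩
    toℕ (lookup (φ z) i) + m   ≤⟨ +-monoˡ-≤ m (∣m-n∣≤1⇒n≤1+m _ _ (close i)) ⟩
    suc (toℕ (lookup (φ x) i)) + m ≡⟨ ≡-sym (+-suc _ m) ⟩
    toℕ (lookup (φ x) i) + suc m ∎
    where open ≤-Reasoning

module ResolvedEmbeddings (G : Graph n) (D : ℕ) (diam : IsDiameter G D) where

  Adj? : Decidable (Adj G)
  Adj? x y with proj₁ diam x y
  ... | d , d-dist , _ with d ≟ 1
  ... | yes refl = yes (Equivalence.to (IsDist-one⇔adjacent (irrefl G)) d-dist)
  ... | no d≢1   = no λ e →
    d≢1 (IsMin-unique d-dist (Equivalence.from (IsDist-one⇔adjacent (irrefl G)) e))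

  module DistanceVectors (H : Graph n) (H-Adj? : Decidable (Adj H)) (G⊆H : Supergraph G H)
                         (w : Fin k → Fin n) (w-resolving : Resolving H w) where

    bounded-distance : ∀ x y → Σ ℕ λ d → IsDist (Adj H) x y d × d ≤ D
    bounded-distance x y with proj₁ diam x y
    ... | dᴳ , (xs , _) , dᴳ≤D with distance H-Adj? (walk-map (G⊆H _ _) xs)
    ... | d , d-dist , d≤dᴳ = d , d-dist , ≤-trans d≤dᴳ dᴳ≤D

    dist : Fin n → Fin n → ℕ
    dist x y = proj₁ (bounded-distance x y)

    dist-IsDist : ∀ x y → IsDist (Adj H) x y (dist x y)
    dist-IsDist x y = proj₁ (proj₂ (bounded-distance x y))

    coordinate : Fin n → Fin k → Fin (suc D)
    coordinate x i = fromℕ< (s≤s (proj₂ (proj₂ (bounded-distance (w i) x))))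

    coordinates : Vec (Vec (Fin (suc D)) k) n
    coordinates = tabulate λ x → tabulate (coordinate x)

    φ : Fin n → Vec (Fin (suc D)) k
    φ = lookup coordinates

    φ-coordinate : ∀ x i → toℕ (lookup (φ x) i) ≡ dist (w i) x
    φ-coordinate x i = begin
      toℕ (lookup (φ x) i)
        ≡⟨ cong (λ v → toℕ (lookup v i)) (lookup∘tabulate _ x) ⟩
      toℕ (lookup (tabulate (coordinate x)) i)
        ≡⟨ cong toℕ (lookup∘tabulate _ i) ⟩
      toℕ (coordinate x i)
        ≡⟨ toℕ-fromℕ< _ ⟩
      dist (w i) x ∎
      where open ≡-Reasoning

    φ-injective : Injective _≡_ _≡_ φ
    φ-injective {x} {y} φx≡φy with x ≟ᶠ y
    ... | yes x≡y = x≡y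
    ... | no x≢y with w-resolving x y x≢y
    ... | i , a , b , a-dist , b-dist , a≢b = ⊥-elim (a≢b (begin
      a                    ≡⟨ IsMin-unique (IsDist-sym (Graph.sym H) a-dist) (dist-IsDist (w i) x) ⟩
      dist (w i) x         ≡⟨ ≡-sym (φ-coordinate x i) ⟩
      toℕ (lookup (φ x) i) ≡⟨ cong (λ v → toℕ (lookup v i)) φx≡φy ⟩
      toℕ (lookup (φ y) i) ≡⟨ φ-coordinate y i ⟩
      dist (w i) y         ≡⟨ IsMin-unique (dist-IsDist (w i) y) (IsDist-sym (Graph.sym H) b-dist) ⟩
      b                    ∎))
      where open ≡-Reasoning

    φ-Adj : ∀ {x y} → Adj H x y → StrongAdj (φ x) (φ y)
    φ-Adj {x} {y} e = (λ φx≡φy → irrefl H (subst (Adj H x) (≡-sym (φ-injective φx≡φy)) e)) , λ i →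
      subst₂ (λ p q → ∣ p - q ∣ ≤ 1) (≡-sym (φ-coordinate x i)) (≡-sym (φ-coordinate y i))
        (∣m-n∣≤1 _ _ (IsDist-step (dist-IsDist (w i) x) e (dist-IsDist (w i) y))
                     (IsDist-step (dist-IsDist (w i) y) (Graph.sym H e) (dist-IsDist (w i) x)))

    φ-centre : ∀ i → toℕ (lookup (φ (w i)) i) ≡ 0
    φ-centre i = trans (φ-coordinate (w i) i) (IsMin-unique (dist-IsDist (w i) (w i)) IsDist-refl)

    φ-resolved : IsWResolvedEmbedding G w φ
    φ-resolved = (φ-injective , λ x y e → φ-Adj (G⊆H x y e)) , λ x i →
      subst (Walk (ImageAdj φ) (w i) x) (≡-sym (φ-coordinate x i))
            (walk-map φ-Adj (proj₁ (dist-IsDist (w i) x))) ,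
      λ m xs → subst (λ c → toℕ (lookup (φ x) i) ≤ c + m) (φ-centre i) (coordinate-≤ φ i xs)

  -- Vectors rather than functions, so that the finitely many candidates can be searched
  -- exhaustively (without function extensionality a search over Fin k → A is incomplete).
  ResolvedEmbeddingVec : ℕ → Set
  ResolvedEmbeddingVec k = Σ (Vec (Fin n) k) λ ws → Σ (Vec (Vec (Fin (suc D)) k) n) λ φs →
    Injective _≡_ _≡_ (lookup ws) × IsWResolvedEmbedding G (lookup ws) (lookup φs)

  IsWResolvedEmbedding? : (w : Fin k → Fin n) (φ : Fin n → Vec (Fin (suc D)) k) →
                          Dec (IsWResolvedEmbedding G w φ)
  IsWResolvedEmbedding? w φ =
    (injective? (≡-dec _≟ᶠ_) φ ×-dec all? λ x → all? λ y → Adj? x y →-dec StrongAdj? (φ x) (φ y))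
    ×-dec all? λ x → all? λ i → IsDist? (λ a b → StrongAdj? (φ a) (φ b)) (w i) x _

  ResolvedEmbeddingVec? : ∀ k → Dec (ResolvedEmbeddingVec k)
  ResolvedEmbeddingVec? k = Vec-searchable Fin-searchable k λ ws →
    Vec-searchable (Vec-searchable Fin-searchable k) n λ φs →
      injective? _≟ᶠ_ (lookup ws) ×-dec IsWResolvedEmbedding? (lookup ws) (lookup φs)

  resolving⇒resolvedEmbeddingVec : (H : Graph n) → Decidable (Adj H) → Supergraph G H →
    HasResolvingSetOfSize H k → ResolvedEmbeddingVec k
  resolving⇒resolvedEmbeddingVec H H-Adj? G⊆H ((w , w-injective) , w-resolving) =
    tabulate w , coordinates , w′-injective , φ-resolved
    where
    w≗w′ : ∀ i → w i ≡ lookup (tabulate w) i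
    w≗w′ i = ≡-sym (lookup∘tabulate w i)

    w′-injective : Injective _≡_ _≡_ (lookup (tabulate w))
    w′-injective {i} {j} eq = w-injective (trans (w≗w′ i) (trans eq (≡-sym (w≗w′ j))))

    w′-resolving : Resolving H (lookup (tabulate w))
    w′-resolving u v u≢v with w-resolving u v u≢v
    ... | i , a , b , a-dist , b-dist , a≢b =
      i , a , b , subst (λ z → IsDist (Adj H) u z a) (w≗w′ i) a-dist ,
                  subst (λ z → IsDist (Adj H) v z b) (w≗w′ i) b-dist , a≢b

    open DistanceVectors H H-Adj? G⊆H (lookup (tabulate w)) w′-resolving

  resolving⇒resolvedEmbedding : (H : Graph n) → Supergraph G H →
    HasResolvingSetOfSize H k → HasResolvedEmbeddingOfSize G (suc D) k
  -- Adjacency in H need not be decidable, but that is irrefutable, and the goal is decidable.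
  resolving⇒resolvedEmbedding {k} H G⊆H W =
    forget-vectors (decidable-stable (ResolvedEmbeddingVec? k) λ ¬embedding →
      ¬¬-decidable (Adj H) λ H-Adj? → ¬embedding (resolving⇒resolvedEmbeddingVec H H-Adj? G⊆H W))
    where
    forget-vectors : ResolvedEmbeddingVec k → HasResolvedEmbeddingOfSize G (suc D) k
    forget-vectors (ws , φs , ws-injective , resolved) =
      (lookup ws , ws-injective) , lookup φs , resolved

  resolvedEmbedding⇒resolving : HasResolvedEmbeddingOfSize G (suc D) k →
    Σ (Graph n) λ H → Supergraph G H × HasResolvingSetOfSize H k
  resolvedEmbedding⇒resolving {k} (W@(w , _) , φ , (φ-injective , φ-Adj) , φ-dist) =
    imageGraph φ , φ-Adj , W , resolving
    where
    resolving : Resolving (imageGraph φ) w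
    resolving u v u≢v with ¬∀⟶∃¬ k _ (λ i → lookup (φ u) i ≟ᶠ lookup (φ v) i)
                                (λ same → u≢v (φ-injective (lookup-ext (φ u) (φ v) same)))
    ... | i , differ = i , _ , _ , IsDist-sym StrongAdj-sym (φ-dist u i) ,
                       IsDist-sym StrongAdj-sym (φ-dist v i) , differ ∘ toℕ-injective

  threshold≤resolving : ∀ {t} → IsThresholdDim G t → (H : Graph n) → Supergraph G H →
    HasResolvingSetOfSize H k → t ≤ k
  -- β(H) exists only up to double negation, which suffices for the decidable goal t ≤ k.
  threshold≤resolving {k} {t} (_ , t-min) H G⊆H W = decidable-stable (t ≤? k) λ t≰k →
    ¬¬-minimum k W λ (s , β@(_ , s-min)) → t≰k (≤-trans (t-min s (H , G⊆H , β)) (s-min k W))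

  embedding-min≤resolving : ∀ {t} → IsMin (HasResolvedEmbeddingOfSize G (suc D)) t →
    (H : Graph n) → Supergraph G H → HasResolvingSetOfSize H k → t ≤ k
  embedding-min≤resolving {k} (_ , t-min) H G⊆H W = t-min k (resolving⇒resolvedEmbedding H G⊆H W)

corollary7 : (n : ℕ) (G : Graph n) (D : ℕ) → Connected G → IsDiameter G D →
    ∀ t → IsThresholdDim G t ⇔ IsMin (HasResolvedEmbeddingOfSize G (suc D)) t
corollary7 n G D _ diam t = mk⇔ threshold⇒embedding-min embedding-min⇒threshold
  where
  open ResolvedEmbeddings G D diam

  threshold⇒embedding-min : IsThresholdDim G t → IsMin (HasResolvedEmbeddingOfSize G (suc D)) t
  threshold⇒embedding-min τ@((H , G⊆H , W , _) , _) =
    resolving⇒resolvedEmbedding H G⊆H W ,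
    λ k embedding → let (H′ , G⊆H′ , W′) = resolvedEmbedding⇒resolving embedding
                    in threshold≤resolving τ H′ G⊆H′ W′

  embedding-min⇒threshold : IsMin (HasResolvedEmbeddingOfSize G (suc D)) t → IsThresholdDim G t
  embedding-min⇒threshold ε@(embedding , _) =
    let (H , G⊆H , W) = resolvedEmbedding⇒resolving embedding
    in (H , G⊆H , W , λ s → embedding-min≤resolving ε H G⊆H) ,
       λ s (H′ , G⊆H′ , W′ , _) → embedding-min≤resolving ε H′ G⊆H′ W′
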